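{- Let $q>2$ be an odd integer. Then $$\lim_{x\to\infty}\frac{\#\{n\le x: f_{2,q}(n+1)=f_{2,q}(n)\}}{x}=\frac{q-1}{q},$$ where $n$ ranges over positive integers.
   Context: $\mathbb{N}$ denotes the set of nonnegative integers. For an odd integer $q>2$, $f_{2,q}(n)$ denotes the number of different expressions of the positive integer $n$ as a sum of distinct terms taken from $\{2^{\alpha}q^{\beta}:\alpha,\beta\in\mathbb{N}\}$ (i.e. the number of finite subsets of this set whose elements sum to $n$). -}

module Defs where

open import Data.Nat using (ℕ; zero; suc; _+_; _*_; _^_; _≤?_; _≟_)
open import Data.List using (List; []; _∷_; map; filter; length; concatMap; upTo; _++_)
open import Data.Nat.ListAction using (sum)
open import Data.Integer using (+_)
open import Data.Rational using (ℚ; 0ℚ; _/_)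

sublists : {A : Set} → List A → List (List A)
sublists [] = [] ∷ []
sublists (x ∷ xs) = sublists xs ++ map (x ∷_) (sublists xs)

-- the elements 2^a q^b (a, b ≤ n) that are ≤ n; every element of
-- {2^α q^β} that is ≤ n arises this way (since 2^α ≤ n ⇒ α ≤ n, q ≥ 2),
-- and distinct pairs give distinct values for odd q > 1.
terms : ℕ → ℕ → List ℕ
terms q n =
  filter (_≤? n)
    (concatMap (λ a → map (λ b → 2 ^ a * q ^ b) (upTo (suc n))) (upTo (suc n)))

-- f_{2,q}(n): number of finite subsets of {2^α q^β} summing to n
-- (any such subset consists of elements ≤ n)
f : ℕ → ℕ → ℕ
f q n = length (filter (λ s → sum s ≟ n) (sublists (terms q n)))

count : ℕ → ℕ → ℕ
count q x = length (filter (λ n → f q (suc n) ≟ f q n) (map suc (upTo x)))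

-- m / d as a rational (d = 0 gives 0; only used with d ≥ 1)
_÷_ : ℕ → ℕ → ℚ
m ÷ zero = 0ℚ
m ÷ suc d = (+ m) / suc d

module Submission where

-- The terms 2^a q^b are the powers of 2 together with q times the terms, so the generating
-- function F(X) = ∏ (1 + X^t) of f satisfies F(X) = F(X^q) / (1 − X), because every
-- number is a sum of distinct powers of 2 in exactly one way. Hence f (n + 1) − f n is
-- f ((n + 1) / q) when q ∣ n + 1 and 0 otherwise, and as f is positive, f (n + 1) = f n
-- exactly when q ∤ n + 1. The count up to x is therefore x − ⌊(x + 1) / q⌋, which is within
-- 1 of (q − 1) x / q. The infinite product is replaced throughout by the finite products over
-- the terms 2^a q^b with a < A and b < B, whose coefficient of X^n does not depend on A, B > n.

open import Data.Empty using (⊥-elim)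
open import Data.Integer as ℤ using (ℤ; +<+; +≤+)
import Data.Integer.Properties as ℤ
import Data.Integer.Tactic.RingSolver as ℤ-Solver
open import Data.List using (List; []; _∷_; [_]; _++_; map; filter; length; concatMap; upTo)
open import Data.List.Properties
  using ( ++-assoc; ++-identityʳ; map-++; map-∘; map-cong; length-map; length-++; upTo-∷ʳ; map-upTo
        ; concatMap-++; concatMap-cong; concatMap-map; concatMap-pure; map-concatMap
        ; filter-++; filter-accept; filter-reject; filter-none; filter-≐ )
open import Data.List.Relation.Binary.Permutation.Propositional as ↭ using (_↭_)
import Data.List.Relation.Binary.Permutation.Propositional.Properties as ↭
open import Data.List.Relation.Unary.All as All using (All)
open import Data.List.Relation.Unary.All.Properties using (map⁺)
open import Data.Nat
  using (ℕ; zero; suc; _+_; _*_; _^_; _∸_; _%_; _≤_; _<_; _≤′_; _≤?_; _≟_; z≤n; s≤s; z<s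
        ; ≤′-refl; ≤′-step; NonZero; >-nonZero)
open import Data.Nat.ListAction using (sum)
open import Data.Nat.Properties
open import Algebra.Properties.CommutativeSemigroup +-commutativeSemigroup using (interchange)
open import Algebra.Properties.CommutativeSemigroup *-commutativeSemigroup
  using () renaming (x∙yz≈y∙xz to x*[y*z]≡y*[x*z])
open import Data.Nat.Tactic.RingSolver using (solve-∀)
open import Data.Product using (∃; ∃₂; _,_; _×_)
open import Data.Rational as ℚ using (ℚ; 0ℚ; mkℚ; toℚᵘ; ∣_∣; _-_) renaming (_<_ to _<ℚ_; _≤_ to _≤ℚ_)
open import Data.Rational.Properties as ℚ
  using (toℚᵘ-fromℚᵘ; toℚᵘ-homo-∣-∣; toℚᵘ-homo-+; toℚᵘ-homo‿-; toℚᵘ-cancel-<; toℚᵘ-cancel-≤)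
open import Data.Rational.Unnormalised as ℚᵘ using (mkℚᵘ; *<*; *≤*) renaming (_≃_ to _≃ᵘ_)
import Data.Rational.Unnormalised.Properties as ℚᵘ
open import Data.Sum using (_⊎_; inj₁; inj₂)
open import Function using (_∘_)
open import Relation.Binary.PropositionalEquality
  using (_≡_; _≢_; _≗_; refl; sym; trans; cong; cong₂; subst; subst₂; module ≡-Reasoning)
open import Relation.Nullary using (¬_; Dec; yes; no)

open import Defs

-- Subset sums as coefficients of ∏ (1 + X^x)

-- shift x h is the coefficient sequence of X^x · h, and ways L that of ∏_{x ∈ L} (1 + X^x).
shift : ℕ → (ℕ → ℕ) → ℕ → ℕ
shift x h n with x ≤? n
... | yes _ = h (n ∸ x)
... | no  _ = 0

ways : List ℕ → ℕ → ℕ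
ways []       zero    = 1
ways []       (suc _) = 0
ways (x ∷ xs) n       = ways xs n + shift x (ways xs) n

filter-map : ∀ {A B : Set} {P : B → Set} (P? : ∀ b → Dec (P b)) (g : A → B) xs →
             filter P? (map g xs) ≡ map g (filter (P? ∘ g) xs)
filter-map P? g []       = refl
filter-map P? g (x ∷ xs) with P? (g x)
... | yes _ = cong (g x ∷_) (filter-map P? g xs)
... | no  _ = filter-map P? g xs

sums-to? : ∀ n (s : List ℕ) → Dec (sum s ≡ n)
sums-to? n s = sum s ≟ n

#sums-to : ℕ → List (List ℕ) → ℕ
#sums-to n ss = length (filter (sums-to? n) ss)

#sums-to-++ : ∀ n ss tt → #sums-to n (ss ++ tt) ≡ #sums-to n ss + #sums-to n tt
#sums-to-++ n ss tt = trans (cong length (filter-++ (sums-to? n) ss tt)) (length-++ (filter (sums-to? n) ss))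

#sums-to-map-∷ : ∀ {x n} → x ≤ n → ∀ ss → #sums-to n (map (x ∷_) ss) ≡ #sums-to (n ∸ x) ss
#sums-to-map-∷ {x} {n} x≤n ss = begin
  length (filter (sums-to? n) (map (x ∷_) ss))          ≡⟨ cong length (filter-map (sums-to? n) (x ∷_) ss) ⟩
  length (map (x ∷_) (filter (sums-to? n ∘ (x ∷_)) ss)) ≡⟨ length-map (x ∷_) (filter (sums-to? n ∘ (x ∷_)) ss) ⟩
  length (filter (sums-to? n ∘ (x ∷_)) ss)              ≡⟨ cong length (filter-≐ _ _ ((λ {s} → to {s}) , (λ {s} → from {s})) ss) ⟩
  length (filter (sums-to? (n ∸ x)) ss)                 ∎
  where
  open ≡-Reasoning
  to : ∀ {s} → x + sum s ≡ n → sum s ≡ n ∸ x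
  to {s} x+s≡n = trans (sym (m+n∸m≡n x (sum s))) (cong (_∸ x) x+s≡n)
  from : ∀ {s} → sum s ≡ n ∸ x → x + sum s ≡ n
  from s≡n∸x = trans (cong (x +_) s≡n∸x) (m+[n∸m]≡n x≤n)

#sums-to-map-∷-large : ∀ {x n} → ¬ x ≤ n → ∀ ss → #sums-to n (map (x ∷_) ss) ≡ 0
#sums-to-map-∷-large {x} {n} x≰n ss =
  trans (cong length (filter-map (sums-to? n) (x ∷_) ss))
        (cong (length ∘ map (x ∷_)) (filter-none (sums-to? n ∘ (x ∷_)) (All.universal too-large ss)))
  where
  too-large : ∀ s → x + sum s ≢ n
  too-large s x+s≡n = x≰n (subst (x ≤_) x+s≡n (m≤m+n x (sum s)))

#sums-to-sublists : ∀ L n → #sums-to n (sublists L) ≡ ways L n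
#sums-to-sublists []       zero    = refl
#sums-to-sublists []       (suc n) = refl
#sums-to-sublists (x ∷ xs) n =
  trans (#sums-to-++ n (sublists xs) _) (cong₂ _+_ (#sums-to-sublists xs n) containing-x)
  where
  containing-x : #sums-to n (map (x ∷_) (sublists xs)) ≡ shift x (ways xs) n
  containing-x with x ≤? n
  ... | yes x≤n = trans (#sums-to-map-∷ x≤n (sublists xs)) (#sums-to-sublists xs (n ∸ x))
  ... | no  x≰n = #sums-to-map-∷-large x≰n (sublists xs)

shift-cong : ∀ x {h h′} → h ≗ h′ → shift x h ≗ shift x h′
shift-cong x h≗h′ n with x ≤? n
... | yes _ = h≗h′ (n ∸ x)
... | no  _ = refl

shift-+ : ∀ x h h′ n → shift x (λ m → h m + h′ m) n ≡ shift x h n + shift x h′ n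
shift-+ x h h′ n with x ≤? n
... | yes _ = refl
... | no  _ = refl

shift-shift : ∀ x y h n → shift x (shift y h) n ≡ shift (x + y) h n
shift-shift x y h n with x ≤? n
shift-shift x y h n | no x≰n with x + y ≤? n
... | no  _     = refl
... | yes x+y≤n = ⊥-elim (x≰n (≤-trans (m≤m+n x y) x+y≤n))
shift-shift x y h n | yes x≤n with y ≤? n ∸ x | x + y ≤? n
... | no  _     | no  _     = refl
... | no  y≰n∸x | yes x+y≤n = ⊥-elim (y≰n∸x (subst (_≤ n ∸ x) (m+n∸m≡n x y) (∸-monoˡ-≤ x x+y≤n)))
... | yes _     | yes _     = cong h (∸-+-assoc n x y)
... | yes y≤n∸x | no  x+y≰n = ⊥-elim (x+y≰n (subst (x + y ≤_) (m+[n∸m]≡n x≤n) (+-monoʳ-≤ x y≤n∸x)))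

shift-comm : ∀ x y h → shift x (shift y h) ≗ shift y (shift x h)
shift-comm x y h n = begin
  shift x (shift y h) n  ≡⟨ shift-shift x y h n ⟩
  shift (x + y) h n      ≡⟨ cong (λ z → shift z h n) (+-comm x y) ⟩
  shift (y + x) h n      ≡⟨ shift-shift y x h n ⟨
  shift y (shift x h) n  ∎
  where open ≡-Reasoning

ways-∷-cong : ∀ x {xs ys} → ways xs ≗ ways ys → ways (x ∷ xs) ≗ ways (x ∷ ys)
ways-∷-cong x xs≗ys n = cong₂ _+_ (xs≗ys n) (shift-cong x xs≗ys n)

ways-swap : ∀ x y zs → ways (x ∷ y ∷ zs) ≗ ways (y ∷ x ∷ zs)
ways-swap x y zs n = begin
  (w n + shift y w n) + shift x (λ m → w m + shift y w m) n
    ≡⟨ cong ((w n + shift y w n) +_) (shift-+ x w (shift y w) n) ⟩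
  (w n + shift y w n) + (shift x w n + shift x (shift y w) n)
    ≡⟨ cong ((w n + shift y w n) +_) (cong (shift x w n +_) (shift-comm x y w n)) ⟩
  (w n + shift y w n) + (shift x w n + shift y (shift x w) n)
    ≡⟨ interchange (w n) (shift y w n) (shift x w n) (shift y (shift x w) n) ⟩
  (w n + shift x w n) + (shift y w n + shift y (shift x w) n)
    ≡⟨ cong ((w n + shift x w n) +_) (shift-+ y w (shift x w) n) ⟨
  (w n + shift x w n) + shift y (λ m → w m + shift x w m) n ∎
  where
  open ≡-Reasoning
  w = ways zs

ways-↭ : ∀ {xs ys} → xs ↭ ys → ways xs ≗ ways ys
ways-↭ ↭.refl _ = refl
ways-↭ {_ ∷ xs} {_ ∷ ys} (↭.prep x p) = ways-∷-cong x {xs} {ys} (ways-↭ p)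
ways-↭ {_ ∷ _ ∷ xs} {_ ∷ _ ∷ ys} (↭.swap x y p) n =
  trans (ways-∷-cong x {y ∷ xs} {y ∷ ys} (ways-∷-cong y {xs} {ys} (ways-↭ p)) n) (ways-swap x y ys n)
ways-↭ (↭.trans p p′) n = trans (ways-↭ p n) (ways-↭ p′ n)

shift-large : ∀ {x n} h → ¬ x ≤ n → shift x h n ≡ 0
shift-large {x} {n} h x≰n with x ≤? n
... | yes x≤n = ⊥-elim (x≰n x≤n)
... | no  _   = refl

shift-cong-≤ : ∀ x {h h′ m} → (∀ {k} → k ≤ m → h k ≡ h′ k) → ∀ {n} → n ≤ m → shift x h n ≡ shift x h′ n
shift-cong-≤ x h≡h′ {n} n≤m with x ≤? n
... | yes _ = h≡h′ (≤-trans (m∸n≤m n x) n≤m)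
... | no  _ = refl

ways-filter-≤ : ∀ L {m k} → k ≤ m → ways L k ≡ ways (filter (_≤? m) L) k
ways-filter-≤ []       k≤m = refl
ways-filter-≤ (x ∷ xs) {m} {k} k≤m with x ≤? m
... | yes x≤m = begin
  ways xs k + shift x (ways xs) k
    ≡⟨ cong₂ _+_ (ways-filter-≤ xs k≤m) (shift-cong-≤ x (ways-filter-≤ xs) k≤m) ⟩
  ways (x ∷ filter (_≤? m) xs) k
    ≡⟨ cong (λ L → ways L k) (filter-accept (_≤? m) x≤m) ⟨
  ways (filter (_≤? m) (x ∷ xs)) k ∎
  where open ≡-Reasoning
... | no x≰m = begin
  ways xs k + shift x (ways xs) k
    ≡⟨ cong (ways xs k +_) (shift-large (ways xs) (λ x≤k → x≰m (≤-trans x≤k k≤m))) ⟩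
  ways xs k + 0
    ≡⟨ +-identityʳ (ways xs k) ⟩
  ways xs k
    ≡⟨ ways-filter-≤ xs k≤m ⟩
  ways (filter (_≤? m) xs) k
    ≡⟨ cong (λ L → ways L k) (filter-reject (_≤? m) x≰m) ⟨
  ways (filter (_≤? m) (x ∷ xs)) k ∎
  where open ≡-Reasoning

ways-++-large : ∀ xs {ys k} → All (k <_) ys → ways (xs ++ ys) k ≡ ways xs k
ways-++-large xs {ys} {k} k<ys = begin
  ways (xs ++ ys) k                               ≡⟨ ways-filter-≤ (xs ++ ys) ≤-refl ⟩
  ways (filter (_≤? k) (xs ++ ys)) k              ≡⟨ cong (λ L → ways L k) (filter-++ (_≤? k) xs ys) ⟩
  ways (filter (_≤? k) xs ++ filter (_≤? k) ys) k ≡⟨ cong (λ L → ways (filter (_≤? k) xs ++ L) k) ys-dropped ⟩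
  ways (filter (_≤? k) xs ++ []) k                ≡⟨ cong (λ L → ways L k) (++-identityʳ (filter (_≤? k) xs)) ⟩
  ways (filter (_≤? k) xs) k                      ≡⟨ ways-filter-≤ xs ≤-refl ⟨
  ways xs k                                       ∎
  where
  open ≡-Reasoning
  ys-dropped : filter (_≤? k) ys ≡ []
  ys-dropped = filter-none (_≤? k) (All.map <⇒≱ k<ys)

ways-zero-positive : ∀ L → 0 < ways L 0
ways-zero-positive []       = z<s
ways-zero-positive (x ∷ xs) = ≤-trans (ways-zero-positive xs) (m≤m+n _ _)

-- Scaling by q, i.e. substituting X^q for X

module _ (q : ℕ) .{{_ : NonZero q}} where

  shift-* : ∀ {h h′} → (∀ j → h (q * j) ≡ h′ j) → ∀ x j → shift (q * x) h (q * j) ≡ shift x h′ j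
  shift-* {h} {h′} h≡h′ x j with q * x ≤? q * j | x ≤? j
  ... | yes _     | yes x≤j = trans (cong h (sym (*-distribˡ-∸ q j x))) (h≡h′ (j ∸ x))
  ... | yes qx≤qj | no  x≰j = ⊥-elim (x≰j (*-cancelˡ-≤ q qx≤qj))
  ... | no  qx≰qj | yes x≤j = ⊥-elim (qx≰qj (*-monoʳ-≤ q x≤j))
  ... | no  _     | no  _   = refl

  shift-*-+ : ∀ {s h} → s < q → (∀ j → h (s + q * j) ≡ 0) → ∀ x j → shift (q * x) h (s + q * j) ≡ 0
  shift-*-+ {s} {h} s<q h≡0 x j with q * x ≤? s + q * j
  ... | no  _       = refl
  ... | yes qx≤s+qj = trans (cong h s+qj∸qx) (h≡0 (j ∸ x))
    where
    x≤j : x ≤ j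
    x≤j = m<1+n⇒m≤n (*-cancelˡ-< q x (suc j) (begin-strict
      q * x      ≤⟨ qx≤s+qj ⟩
      s + q * j  <⟨ +-monoˡ-< (q * j) s<q ⟩
      q + q * j  ≡⟨ *-suc q j ⟨
      q * suc j  ∎))
      where open ≤-Reasoning
    s+qj∸qx : s + q * j ∸ q * x ≡ s + q * (j ∸ x)
    s+qj∸qx = trans (+-∸-assoc s (*-monoʳ-≤ q x≤j)) (cong (s +_) (sym (*-distribˡ-∸ q j x)))

ways-map-* : ∀ q .{{_ : NonZero q}} L j → ways (map (q *_) L) (q * j) ≡ ways L j
ways-map-* q       []       zero    = cong (ways []) (*-zeroʳ q)
ways-map-* (suc d) []       (suc j) = refl
ways-map-* q       (x ∷ xs) j       = cong₂ _+_ (ways-map-* q xs j) (shift-* q (ways-map-* q xs) x j)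

ways-map-*-+ : ∀ q .{{_ : NonZero q}} {s} → 0 < s → s < q → ∀ L j → ways (map (q *_) L) (s + q * j) ≡ 0
ways-map-*-+ q {suc s} _   s<q []       j = refl
ways-map-*-+ q         0<s s<q (x ∷ xs) j =
  cong₂ _+_ (ways-map-*-+ q 0<s s<q xs j) (shift-*-+ q s<q (ways-map-*-+ q 0<s s<q xs) x j)

-- Binary representations

map-upTo-suc : ∀ {A : Set} (g : ℕ → A) n → map g (upTo (suc n)) ≡ g 0 ∷ map (g ∘ suc) (upTo n)
map-upTo-suc g n = cong (g 0 ∷_) (trans (cong (map g) (sym (map-upTo suc n))) (sym (map-∘ (upTo n))))

even-or-odd : ∀ k → ∃ λ j → k ≡ 2 * j ⊎ k ≡ 1 + 2 * j
even-or-odd zero = 0 , inj₁ refl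
even-or-odd (suc k) with even-or-odd k
... | j , inj₁ refl = j , inj₂ refl
... | j , inj₂ refl = suc j , inj₁ (sym (*-suc 2 j))

ways-1∷map-2* : ∀ {L N} → (∀ {j} → j < N → ways L j ≡ 1) →
                ∀ {k} → k < 2 * N → ways (1 ∷ map (2 *_) L) k ≡ 1
ways-1∷map-2* {L} {N} ways-L {k} k<2N with even-or-odd k
... | j , inj₁ refl = begin
  ways 2L (2 * j) + shift 1 (ways 2L) (2 * j)  ≡⟨ cong₂ _+_ (ways-map-* 2 L j) (shift-1-even j) ⟩
  ways L j + 0                                 ≡⟨ +-identityʳ (ways L j) ⟩
  ways L j                                     ≡⟨ ways-L (*-cancelˡ-< 2 j N k<2N) ⟩
  1                                            ∎
  where
  open ≡-Reasoning
  2L = map (2 *_) L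
  shift-1-even : ∀ j → shift 1 (ways 2L) (2 * j) ≡ 0
  shift-1-even zero    = refl
  shift-1-even (suc j) = trans (cong (shift 1 (ways 2L)) (*-suc 2 j)) (ways-map-*-+ 2 z<s (s≤s z<s) L j)
... | j , inj₂ refl = begin
  ways 2L (1 + 2 * j) + ways 2L (2 * j)  ≡⟨ cong₂ _+_ (ways-map-*-+ 2 z<s (s≤s z<s) L j) (ways-map-* 2 L j) ⟩
  ways L j                               ≡⟨ ways-L (*-cancelˡ-< 2 j N (<-trans (n<1+n (2 * j)) k<2N)) ⟩
  1                                      ∎
  where
  open ≡-Reasoning
  2L = map (2 *_) L

powersOf2 : ℕ → List ℕ
powersOf2 A = map (2 ^_) (upTo A)

ways-powersOf2 : ∀ A {k} → k < 2 ^ A → ways (powersOf2 A) k ≡ 1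
ways-powersOf2 zero    {zero}  _         = refl
ways-powersOf2 zero    {suc k} (s≤s ())
ways-powersOf2 (suc A) {k}     k<2^1+A =
  trans (cong (λ L → ways L k) (map-upTo-suc (2 ^_) A))
        (trans (cong (λ L → ways (1 ∷ L) k) (map-∘ {g = 2 *_} {f = 2 ^_} (upTo A)))
               (ways-1∷map-2* {powersOf2 A} (ways-powersOf2 A) k<2^1+A))

shift-partial-sums : ∀ r {Φ ψ n} → Φ 0 ≡ ψ 0 → (∀ {m} → m ≤ n → Φ (suc m) ≡ Φ m + ψ (suc m)) →
                     shift r Φ (suc n) ≡ shift r Φ n + shift r ψ (suc n)
shift-partial-sums r {Φ} {ψ} {n} base step with r ≤? suc n | r ≤? n
... | yes _    | yes r≤n = trans (cong Φ 1+n∸r) (trans (step (m∸n≤m n r)) (cong (λ i → Φ (n ∸ r) + ψ i) (sym 1+n∸r)))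
  where
  1+n∸r : suc n ∸ r ≡ suc (n ∸ r)
  1+n∸r = +-∸-assoc 1 r≤n
... | yes _    | no  r≰n = trans (cong Φ 1+n∸r) (trans base (cong ψ (sym 1+n∸r)))
  where
  1+n∸r : suc n ∸ r ≡ 0
  1+n∸r = m≤n⇒m∸n≡0 (≰⇒> r≰n)
... | no r≰1+n | yes r≤n = ⊥-elim (r≰1+n (m≤n⇒m≤1+n r≤n))
... | no _     | no _    = refl

-- When the product over P is 1 + X + ⋯ + X^(N − 1), multiplying by it acts below degree N
-- as multiplying by 1 / (1 − X), that is, as taking partial sums.
module _ {P : List ℕ} {N : ℕ} (ways-P : ∀ {k} → k < N → ways P k ≡ 1) where

  ways-++-zero : 0 < N → ∀ R → ways (R ++ P) 0 ≡ ways R 0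
  ways-++-zero 0<N []      = ways-P 0<N
  ways-++-zero 0<N (r ∷ R) = cong₂ _+_ ih (shift-cong-≤ r {ways (R ++ P)} {ways R} {0} (λ { z≤n → ih }) z≤n)
    where ih = ways-++-zero 0<N R

  ways-++-suc : ∀ R {n} → suc n < N → ways (R ++ P) (suc n) ≡ ways (R ++ P) n + ways R (suc n)
  ways-++-suc []      {n} 1+n<N =
    trans (ways-P 1+n<N) (sym (trans (+-identityʳ (ways P n)) (ways-P (<-trans (n<1+n n) 1+n<N))))
  ways-++-suc (r ∷ R) {n} 1+n<N = begin
    Φ (suc n) + shift r Φ (suc n)
      ≡⟨ cong₂ _+_ (ways-++-suc R 1+n<N)
                   (shift-partial-sums r (ways-++-zero (≤-trans z<s 1+n<N) R)
                                         (λ m≤n → ways-++-suc R (≤-<-trans (s≤s m≤n) 1+n<N))) ⟩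
    (Φ n + ways R (suc n)) + (shift r Φ n + shift r (ways R) (suc n))
      ≡⟨ interchange (Φ n) (ways R (suc n)) (shift r Φ n) (shift r (ways R) (suc n)) ⟩
    (Φ n + shift r Φ n) + (ways R (suc n) + shift r (ways R) (suc n)) ∎
    where
    open ≡-Reasoning
    Φ = ways (R ++ P)

concatMap-++-↭ : ∀ {A B : Set} (F G : A → List B) xs →
                 concatMap (λ a → F a ++ G a) xs ↭ concatMap F xs ++ concatMap G xs
concatMap-++-↭ F G []       = ↭.refl
concatMap-++-↭ F G (a ∷ as) = begin
  (F a ++ G a) ++ concatMap (λ a → F a ++ G a) as  ≡⟨ ++-assoc (F a) (G a) _ ⟩
  F a ++ G a ++ concatMap (λ a → F a ++ G a) as    ↭⟨ ↭.++⁺ˡ (F a) (↭.++⁺ˡ (G a) (concatMap-++-↭ F G as)) ⟩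
  F a ++ G a ++ concatMap F as ++ concatMap G as   ↭⟨ ↭.++⁺ˡ (F a) (↭.shifts (G a) (concatMap F as)) ⟩
  F a ++ concatMap F as ++ G a ++ concatMap G as   ≡⟨ ++-assoc (F a) (concatMap F as) _ ⟨
  (F a ++ concatMap F as) ++ G a ++ concatMap G as ∎
  where open ↭.PermutationReasoning

concatMap-singleton : ∀ {A B : Set} (g : A → B) xs → concatMap (λ a → [ g a ]) xs ≡ map g xs
concatMap-singleton g xs = trans (sym (concatMap-map [_] g xs)) (concatMap-pure (map g xs))

map-upTo-∷ʳ : ∀ {A : Set} (g : ℕ → A) n → map g (upTo (suc n)) ≡ map g (upTo n) ++ [ g n ]
map-upTo-∷ʳ g n = trans (cong (map g) (sym (upTo-∷ʳ n))) (map-++ g (upTo n) [ n ])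

n<m^n : ∀ {m} → 1 < m → ∀ n → n < m ^ n
n<m^n         1<m zero    = z<s
n<m^n {m@(suc _)} 1<m (suc n) =
  ≤-<-trans (n<m^n 1<m n) (subst (m ^ n <_) (*-comm (m ^ n) m) (m<m*n (m ^ n) m {{m^n≢0 m n}} 1<m))

row : ℕ → ℕ → ℕ → List ℕ
row q B a = map (λ b → 2 ^ a * q ^ b) (upTo B)

-- terms q n is by definition filter (_≤? n) (grid q (suc n) (suc n)).
grid : ℕ → ℕ → ℕ → List ℕ
grid q A B = concatMap (row q B) (upTo A)

grid-sucˡ : ∀ q A B → grid q (suc A) B ≡ grid q A B ++ row q B A
grid-sucˡ q A B = begin
  concatMap (row q B) (upTo (suc A))     ≡⟨ cong (concatMap (row q B)) (upTo-∷ʳ A) ⟨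
  concatMap (row q B) (upTo A ++ [ A ])  ≡⟨ concatMap-++ (row q B) (upTo A) [ A ] ⟩
  grid q A B ++ row q B A ++ []          ≡⟨ cong (grid q A B ++_) (++-identityʳ (row q B A)) ⟩
  grid q A B ++ row q B A                ∎
  where open ≡-Reasoning

grid-sucʳ : ∀ q A B → grid q A (suc B) ↭ grid q A B ++ map (λ a → 2 ^ a * q ^ B) (upTo A)
grid-sucʳ q A B = begin
  concatMap (row q (suc B)) (upTo A)
    ≡⟨ concatMap-cong (λ a → map-upTo-∷ʳ (λ b → 2 ^ a * q ^ b) B) (upTo A) ⟩
  concatMap (λ a → row q B a ++ [ 2 ^ a * q ^ B ]) (upTo A)
    ↭⟨ concatMap-++-↭ (row q B) (λ a → [ 2 ^ a * q ^ B ]) (upTo A) ⟩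
  grid q A B ++ concatMap (λ a → [ 2 ^ a * q ^ B ]) (upTo A)
    ≡⟨ cong (grid q A B ++_) (concatMap-singleton (λ a → 2 ^ a * q ^ B) (upTo A)) ⟩
  grid q A B ++ map (λ a → 2 ^ a * q ^ B) (upTo A) ∎
  where open ↭.PermutationReasoning

grid-sucʳ-split : ∀ q A B → grid q A (suc B) ↭ powersOf2 A ++ map (q *_) (grid q A B)
grid-sucʳ-split q A B = begin
  concatMap (row q (suc B)) (upTo A)
    ≡⟨ concatMap-cong row-suc (upTo A) ⟩
  concatMap (λ a → [ 2 ^ a ] ++ map (q *_) (row q B a)) (upTo A)
    ↭⟨ concatMap-++-↭ (λ a → [ 2 ^ a ]) (λ a → map (q *_) (row q B a)) (upTo A) ⟩
  concatMap (λ a → [ 2 ^ a ]) (upTo A) ++ concatMap (λ a → map (q *_) (row q B a)) (upTo A)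
    ≡⟨ cong₂ _++_ (concatMap-singleton (2 ^_) (upTo A)) (sym (map-concatMap (q *_) (row q B) (upTo A))) ⟩
  powersOf2 A ++ map (q *_) (grid q A B) ∎
  where
  open ↭.PermutationReasoning
  row-suc : ∀ a → row q (suc B) a ≡ [ 2 ^ a ] ++ map (q *_) (row q B a)
  row-suc a = trans (map-upTo-suc (λ b → 2 ^ a * q ^ b) B)
                    (cong₂ _∷_ (*-identityʳ (2 ^ a))
                               (trans (map-cong (λ b → x*[y*z]≡y*[x*z] (2 ^ a) q (q ^ b)) (upTo B))
                                      (map-∘ (upTo B))))

module _ {q : ℕ} (1<q : 1 < q) where

  private instance
    q-nonZero : NonZero q
    q-nonZero = >-nonZero (<-trans z<s 1<q)

  ways-grid-sucˡ : ∀ {j A} B → j < A → ways (grid q (suc A) B) j ≡ ways (grid q A B) j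
  ways-grid-sucˡ {j} {A} B j<A =
    trans (cong (λ L → ways L j) (grid-sucˡ q A B))
          (ways-++-large (grid q A B) (map⁺ (All.universal j<2^A*q^b (upTo B))))
    where
    j<2^A*q^b : ∀ b → j < 2 ^ A * q ^ b
    j<2^A*q^b b = <-≤-trans (<-trans j<A (n<m^n (s≤s z<s) A)) (m≤m*n (2 ^ A) (q ^ b) {{m^n≢0 q b}})

  ways-grid-sucʳ : ∀ {j} A {B} → j < B → ways (grid q A (suc B)) j ≡ ways (grid q A B) j
  ways-grid-sucʳ {j} A {B} j<B =
    trans (ways-↭ (grid-sucʳ q A B) j)
          (ways-++-large (grid q A B) (map⁺ (All.universal j<2^a*q^B (upTo A))))
    where
    j<2^a*q^B : ∀ a → j < 2 ^ a * q ^ B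
    j<2^a*q^B a = <-≤-trans (<-trans j<B (n<m^n 1<q B)) (m≤n*m (q ^ B) (2 ^ a) {{m^n≢0 2 a}})

  ways-grid-stable : ∀ {j A B} → j < A → j < B → ways (grid q A B) j ≡ ways (grid q (suc j) (suc j)) j
  ways-grid-stable {j} {A} {B} j<A j<B = trans (stableˡ (≤⇒≤′ j<A)) (stableʳ (≤⇒≤′ j<B))
    where
    stableˡ : ∀ {A} → suc j ≤′ A → ways (grid q A B) j ≡ ways (grid q (suc j) B) j
    stableˡ ≤′-refl     = refl
    stableˡ (≤′-step p) = trans (ways-grid-sucˡ B (≤′⇒≤ p)) (stableˡ p)
    stableʳ : ∀ {B} → suc j ≤′ B → ways (grid q (suc j) B) j ≡ ways (grid q (suc j) (suc j)) j
    stableʳ ≤′-refl     = refl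
    stableʳ (≤′-step p) = trans (ways-grid-sucʳ (suc j) (≤′⇒≤ p)) (stableʳ p)

  f≡ways-grid : ∀ {j A B} → j < A → j < B → f q j ≡ ways (grid q A B) j
  f≡ways-grid {j} {A} {B} j<A j<B = begin
    f q j                                            ≡⟨ #sums-to-sublists (terms q j) j ⟩
    ways (filter (_≤? j) (grid q (suc j) (suc j))) j ≡⟨ ways-filter-≤ (grid q (suc j) (suc j)) ≤-refl ⟨
    ways (grid q (suc j) (suc j)) j                  ≡⟨ ways-grid-stable j<A j<B ⟨
    ways (grid q A B) j                              ∎
    where open ≡-Reasoning

  f-suc : ∀ n → f q (suc n) ≡ f q n + ways (map (q *_) (grid q (2 + n) (1 + n))) (suc n)
  f-suc n = begin
    f q (suc n)                                 ≡⟨ f≡ways-split ≤-refl ⟩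
    ways (R ++ powersOf2 A) (suc n)             ≡⟨ ways-++-suc (ways-powersOf2 A) R 1+n<2^A ⟩
    ways (R ++ powersOf2 A) n + ways R (suc n)  ≡⟨ cong (_+ ways R (suc n)) (f≡ways-split (n≤1+n n)) ⟨
    f q n + ways R (suc n)                      ∎
    where
    open ≡-Reasoning
    A = 2 + n
    R = map (q *_) (grid q A (1 + n))
    1+n<2^A : suc n < 2 ^ A
    1+n<2^A = <-trans (n<1+n (suc n)) (n<m^n (s≤s z<s) A)
    f≡ways-split : ∀ {m} → m ≤ suc n → f q m ≡ ways (R ++ powersOf2 A) m
    f≡ways-split {m} m≤1+n = begin
      f q m                      ≡⟨ f≡ways-grid (s≤s m≤1+n) (s≤s m≤1+n) ⟩
      ways (grid q A (2 + n)) m  ≡⟨ ways-↭ (grid-sucʳ-split q A (1 + n)) m ⟩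
      ways (powersOf2 A ++ R) m  ≡⟨ ways-↭ (↭.++-comm (powersOf2 A) R) m ⟩
      ways (R ++ powersOf2 A) m  ∎

  f-positive : ∀ n → 0 < f q n
  f-positive zero    = subst (0 <_) (sym (#sums-to-sublists (terms q 0) 0)) (ways-zero-positive (terms q 0))
  f-positive (suc n) = subst (0 <_) (sym (f-suc n)) (≤-trans (f-positive n) (m≤m+n _ _))

  f-suc-multiple : ∀ {n j} → suc n ≡ q * suc j → f q (suc n) ≡ f q n + f q (suc j)
  f-suc-multiple {n} {j} 1+n≡q[1+j] = trans (f-suc n) (cong (f q n +_) (begin
    ways (map (q *_) G) (suc n)      ≡⟨ cong (ways (map (q *_) G)) 1+n≡q[1+j] ⟩
    ways (map (q *_) G) (q * suc j)  ≡⟨ ways-map-* q G (suc j) ⟩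
    ways G (suc j)                   ≡⟨ f≡ways-grid (<-trans 1+j<1+n (n<1+n (suc n))) 1+j<1+n ⟨
    f q (suc j)                      ∎))
    where
    open ≡-Reasoning
    G = grid q (2 + n) (1 + n)
    1+j<1+n : suc j < suc n
    1+j<1+n = subst (suc j <_) (trans (*-comm (suc j) q) (sym 1+n≡q[1+j])) (m<m*n (suc j) q 1<q)

  f-suc-multiple-≢ : ∀ {n j} → suc n ≡ q * suc j → f q (suc n) ≢ f q n
  f-suc-multiple-≢ {n} {j} 1+n≡q[1+j] same =
    <⇒≢ (m<m+n (f q n) (f-positive (suc j))) (sym (trans (sym (f-suc-multiple 1+n≡q[1+j])) same))

  f-suc-nonmultiple : ∀ {n s j} → 0 < s → s < q → suc n ≡ s + q * j → f q (suc n) ≡ f q n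
  f-suc-nonmultiple {n} {s} {j} 0<s s<q 1+n≡s+qj = begin
    f q (suc n)                              ≡⟨ f-suc n ⟩
    f q n + ways (map (q *_) G) (suc n)      ≡⟨ cong (λ i → f q n + ways (map (q *_) G) i) 1+n≡s+qj ⟩
    f q n + ways (map (q *_) G) (s + q * j)  ≡⟨ cong (f q n +_) (ways-map-*-+ q 0<s s<q G j) ⟩
    f q n + 0                                ≡⟨ +-identityʳ (f q n) ⟩
    f q n                                    ∎
    where
    open ≡-Reasoning
    G = grid q (2 + n) (1 + n)

module _ (q : ℕ) where

  same-f? : (n : ℕ) → Dec (f q (suc n) ≡ f q n)
  same-f? n = f q (suc n) ≟ f q n

  count-suc : ∀ x → count q (suc x) ≡ count q x + length (filter same-f? [ suc x ])
  count-suc x = begin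
    length (filter same-f? (map suc (upTo (suc x))))
      ≡⟨ cong (length ∘ filter same-f?) (map-upTo-∷ʳ suc x) ⟩
    length (filter same-f? (map suc (upTo x) ++ [ suc x ]))
      ≡⟨ cong length (filter-++ same-f? (map suc (upTo x)) [ suc x ]) ⟩
    length (filter same-f? (map suc (upTo x)) ++ filter same-f? [ suc x ])
      ≡⟨ length-++ (filter same-f? (map suc (upTo x))) ⟩
    count q x + length (filter same-f? [ suc x ]) ∎
    where open ≡-Reasoning

  count-suc-≡ : ∀ {x} → f q (2 + x) ≡ f q (1 + x) → count q (suc x) ≡ suc (count q x)
  count-suc-≡ {x} same =
    trans (count-suc x) (trans (cong (λ L → count q x + length L) (filter-accept same-f? same)) (+-comm (count q x) 1))

  count-suc-≢ : ∀ {x} → f q (2 + x) ≢ f q (1 + x) → count q (suc x) ≡ count q x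
  count-suc-≢ {x} differ =
    trans (count-suc x) (trans (cong (λ L → count q x + length L) (filter-reject same-f? differ)) (+-identityʳ (count q x)))

count-invariant : ∀ {q} → 1 < q → ∀ x → ∃₂ λ t r → count q x + t ≡ x × suc x ≡ r + q * t × r < q
count-invariant {q} 1<q zero    = 0 , 1 , refl , cong suc (sym (*-zeroʳ q)) , 1<q
count-invariant {q} 1<q (suc x) with count-invariant 1<q x
... | t , r , C+t≡x , 1+x≡r+qt , r<q with suc r ≟ q
...   | yes 1+r≡q = suc t , 0 , C′+1+t≡1+x , 2+x≡q[1+t] , <-trans z<s 1<q
  where
  2+x≡q[1+t] : suc (suc x) ≡ q * suc t
  2+x≡q[1+t] = trans (cong suc 1+x≡r+qt) (trans (cong (_+ q * t) 1+r≡q) (sym (*-suc q t)))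
  C′+1+t≡1+x : count q (suc x) + suc t ≡ suc x
  C′+1+t≡1+x = trans (cong (_+ suc t) (count-suc-≢ q (f-suc-multiple-≢ 1<q 2+x≡q[1+t])))
                     (trans (+-suc (count q x) t) (cong suc C+t≡x))
...   | no 1+r≢q = t , suc r , C′+t≡1+x , cong suc 1+x≡r+qt , 1+r<q
  where
  1+r<q : suc r < q
  1+r<q = ≤∧≢⇒< r<q 1+r≢q
  C′+t≡1+x : count q (suc x) + t ≡ suc x
  C′+t≡1+x = trans (cong (_+ t) (count-suc-≡ q (f-suc-nonmultiple 1<q z<s 1+r<q (cong suc 1+x≡r+qt))))
                   (cong suc C+t≡x)

count-identity : ∀ {d} → 0 < d → ∀ x → ∃ λ r → r ≤ d × count (suc d) x * suc d + 1 ≡ d * x + r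
count-identity {d} 0<d x with count-invariant (s≤s 0<d) x
... | t , r , C+t≡x , 1+x≡r+qt , s≤s r≤d = r , r≤d , +-cancelʳ-≡ (suc d * t) _ _ (begin
  C * suc d + 1 + suc d * t  ≡⟨ regroup C t d ⟩
  (C + t) * suc d + 1        ≡⟨ cong (λ y → y * suc d + 1) C+t≡x ⟩
  x * suc d + 1              ≡⟨ expand x d ⟩
  d * x + suc x              ≡⟨ cong (d * x +_) 1+x≡r+qt ⟩
  d * x + (r + suc d * t)    ≡⟨ +-assoc (d * x) r (suc d * t) ⟨
  d * x + r + suc d * t      ∎)
  where
  open ≡-Reasoning
  C = count (suc d) x
  regroup : ∀ C t d → C * suc d + 1 + suc d * t ≡ (C + t) * suc d + 1
  regroup = solve-∀
  expand : ∀ x d → x * suc d + 1 ≡ d * x + suc x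
  expand = solve-∀

-- Imported this late because with +_ in scope the sections (x +_) above would be ambiguous.
open import Data.Integer using (+_)

toℚᵘ-÷ : ∀ m n → toℚᵘ (m ÷ suc n) ≃ᵘ mkℚᵘ (+ m) n
toℚᵘ-÷ m n = toℚᵘ-fromℚᵘ (mkℚᵘ (+ m) n)

toℚᵘ-∣÷-÷∣ : ∀ a m b n → toℚᵘ ∣ a ÷ suc m - b ÷ suc n ∣ ≃ᵘ ℚᵘ.∣ mkℚᵘ (+ a) m ℚᵘ.- mkℚᵘ (+ b) n ∣
toℚᵘ-∣÷-÷∣ a m b n =
  ℚᵘ.≃-trans (toℚᵘ-homo-∣-∣ (a ÷ suc m - b ÷ suc n))
    (ℚᵘ.∣-∣-cong (ℚᵘ.≃-trans (toℚᵘ-homo-+ (a ÷ suc m) (ℚ.- (b ÷ suc n)))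
      (ℚᵘ.+-cong (toℚᵘ-÷ a m) (ℚᵘ.≃-trans (toℚᵘ-homo‿- (b ÷ suc n)) (ℚᵘ.-‿cong (toℚᵘ-÷ b n))))))

-- The numerator of C / (x + 1) − d / (d + 1) is C (d + 1) − d (x + 1) = r − 1.
∣÷-÷∣<1÷ : ∀ {C d x r} → 0 < d → r ≤ d → C * suc d + 1 ≡ d * suc x + r →
           ∣ C ÷ suc x - d ÷ suc d ∣ <ℚ 1 ÷ suc x
∣÷-÷∣<1÷ {C} {d} {x} {r} 0<d r≤d C[1+d]+1≡d[1+x]+r =
  toℚᵘ-cancel-< (ℚᵘ.<-respˡ-≃ (ℚᵘ.≃-sym (toℚᵘ-∣÷-÷∣ C x d d))
                (ℚᵘ.<-respʳ-≃ (ℚᵘ.≃-sym (toℚᵘ-÷ 1 x)) (*<* numerators<)))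
  where
  z : ℤ
  z = + C ℤ.* + suc d ℤ.+ ℤ.- (+ d) ℤ.* + suc x
  z≡r-1 : z ≡ + r ℤ.- + 1
  z≡r-1 = begin
    z                                                        ≡⟨ expand (+ C) (+ suc d) (+ d) (+ suc x) ⟩
    (+ C ℤ.* + suc d ℤ.+ + 1) ℤ.- + d ℤ.* + suc x ℤ.- + 1  ≡⟨ cong (λ w → w ℤ.- + d ℤ.* + suc x ℤ.- + 1) cast ⟩
    (+ d ℤ.* + suc x ℤ.+ + r) ℤ.- + d ℤ.* + suc x ℤ.- + 1  ≡⟨ cancel (+ d ℤ.* + suc x) (+ r) ⟩
    + r ℤ.- + 1                                              ∎
    where
    open ≡-Reasoning
    expand : ∀ c q d x → c ℤ.* q ℤ.+ ℤ.- d ℤ.* x ≡ (c ℤ.* q ℤ.+ + 1) ℤ.- d ℤ.* x ℤ.- + 1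
    expand = ℤ-Solver.solve-∀
    cancel : ∀ a r → (a ℤ.+ r) ℤ.- a ℤ.- + 1 ≡ r ℤ.- + 1
    cancel = ℤ-Solver.solve-∀
    cast : + C ℤ.* + suc d ℤ.+ + 1 ≡ + d ℤ.* + suc x ℤ.+ + r
    cast = trans (cong (ℤ._+ + 1) (sym (ℤ.pos-* C (suc d))))
                 (trans (cong +_ C[1+d]+1≡d[1+x]+r) (cong (ℤ._+ + r) (ℤ.pos-* d (suc x))))
  ∣r-1∣≤d : ∀ {r} → r ≤ d → ℤ.∣ + r ℤ.- + 1 ∣ ≤ d
  ∣r-1∣≤d {zero}  _   = 0<d
  ∣r-1∣≤d {suc r} r<d = ≤-trans (n≤1+n r) r<d
  ∣z∣[1+x]<[1+x][1+d] : ℤ.∣ z ∣ * suc x < suc x * suc d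
  ∣z∣[1+x]<[1+x][1+d] = begin-strict
    ℤ.∣ z ∣ * suc x  ≤⟨ *-monoˡ-≤ (suc x) (subst (λ w → ℤ.∣ w ∣ ≤ d) (sym z≡r-1) (∣r-1∣≤d r≤d)) ⟩
    d * suc x        <⟨ *-monoˡ-< (suc x) (n<1+n d) ⟩
    suc d * suc x    ≡⟨ *-comm (suc d) (suc x) ⟩
    suc x * suc d    ∎
    where open ≤-Reasoning
  numerators< : + ℤ.∣ z ∣ ℤ.* + suc x ℤ.< + 1 ℤ.* + (suc x * suc d)
  numerators< = subst₂ ℤ._<_ (ℤ.pos-* ℤ.∣ z ∣ (suc x)) (sym (ℤ.*-identityˡ _)) (+<+ ∣z∣[1+x]<[1+x][1+d])

eventually-1÷suc≤ : ∀ {ε} → 0ℚ <ℚ ε → ∃ λ m → ∀ {x} → m ≤ x → 1 ÷ suc x ≤ℚ ε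
eventually-1÷suc≤ {mkℚ (+ zero)  _ _} (ℚ.*<* (+<+ ()))
eventually-1÷suc≤ {mkℚ (+ suc n) m _} _ = m , λ {x} m≤x →
  toℚᵘ-cancel-≤ (ℚᵘ.≤-respˡ-≃ (ℚᵘ.≃-sym (toℚᵘ-÷ 1 x))
    (*≤* (subst₂ ℤ._≤_ (sym (ℤ.*-identityˡ (+ suc m))) (ℤ.pos-* (suc n) (suc x))
                       (+≤+ (≤-trans (s≤s m≤x) (m≤n*m (suc x) (suc n)))))))

count÷-error<1÷ : ∀ {q} → 1 < q → ∀ x → ∣ count q (suc x) ÷ suc x - (q ∸ 1) ÷ q ∣ <ℚ 1 ÷ suc x
count÷-error<1÷ {suc d} (s≤s 0<d) x =
  let r , r≤d , identity = count-identity 0<d (suc x)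
  in  ∣÷-÷∣<1÷ {count (suc d) (suc x)} {d} {x} {r} 0<d r≤d identity

corollary5 : (q : ℕ) → 2 < q → q % 2 ≡ 1 →
    (ε : ℚ) → 0ℚ <ℚ ε →
      ∃ λ N → (x : ℕ) → N ≤ x →
        ∣ (count q x ÷ x) - ((q ∸ 1) ÷ q) ∣ <ℚ ε
corollary5 q 2<q _ ε 0<ε =
  let m , 1÷[1+x]≤ε = eventually-1÷suc≤ 0<ε
  in  suc m , λ where
        (suc x) (s≤s m≤x) → ℚ.<-≤-trans (count÷-error<1÷ (<⇒≤ 2<q) x) (1÷[1+x]≤ε m≤x)
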